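{- Let $N$ be a positive integer with three decompositions as sums of three positive integers, $$N = (N-i-j) + i + j,\qquad N = a_1+a_2+a_3,\qquad N = b_1+b_2+b_3,$$ such that for every prime $p$ dividing $N(N-1)(N-2)$, at least one of these three decompositions is $p$-acceptable. Suppose moreover that $i$ and $j$ are relatively prime to one another, and that $N-i-j$ is relatively prime to $i+j-1$. Call a prime $p$ relevant if $p$ divides $N(N-1)(N-2)$ but neither of the decompositions $N=a_1+a_2+a_3$, $N=b_1+b_2+b_3$ is $p$-acceptable. Then no prime divisor of $N$ or of $N-1$ is relevant; hence $C$ divides $N-2$, where $C$ is the product of the relevant prime power factors of $N-2$, the squares of the relevant prime power factors of $N-1$, and the cubes of the relevant prime power factors of $N$ (a relevant prime power factor of $m\in\{N,N-1,N-2\}$ being $p^{d}$ with $p$ relevant, $d>0$, and $p^d$ the exact power of $p$ dividing $m$).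
   Context: For a prime $p$, a decomposition $N = c_1 + \dots + c_k$ of a positive integer $N$ as a sum of positive integers is called $p$-acceptable if the multinomial coefficient $N!/(c_1!\cdots c_k!)$ is not divisible by $p$; equivalently, for each $t\ge 0$, the coefficient of $p^t$ in the base-$p$ expansion of $N$ equals the sum of the coefficients of $p^t$ in the base-$p$ expansions of $c_1,\dots,c_k$ (no carrying in base $p$). -}

module Defs where

open import Data.Nat using (ℕ; zero; suc; _+_; _*_; _∸_; _^_; _/_; _≟_; NonZero; _!)
open import Data.Nat.Properties using (_!≢0; m*n≢0)

open import Data.Nat.Divisibility using (_∣_; _∣?_)
open import Data.Nat.Primality using (Prime; prime?)
open import Data.List using (List; upTo; map)
open import Data.Nat.ListAction using (product)
open import Data.Product using (_×_)
open import Relation.Nullary using (¬_; Dec; does; _×-dec_; ¬?)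
open import Data.Bool using (if_then_else_; _∧_; not)

multinomial3 : ℕ → ℕ → ℕ → ℕ → ℕ
multinomial3 n c₁ c₂ c₃ = (n !) / (c₁ ! * c₂ ! * c₃ !)
  where
  instance
    _ = m*n≢0 (c₁ ! * c₂ !) (c₃ !) {{m*n≢0 (c₁ !) (c₂ !) {{c₁ !≢0}} {{c₂ !≢0}}}} {{c₃ !≢0}}

Acceptable : (p N c₁ c₂ c₃ : ℕ) → Set
Acceptable p N c₁ c₂ c₃ = ¬ (p ∣ multinomial3 N c₁ c₂ c₃)

acceptable? : (p N c₁ c₂ c₃ : ℕ) → Dec (Acceptable p N c₁ c₂ c₃)
acceptable? p N c₁ c₂ c₃ = ¬? (p ∣? multinomial3 N c₁ c₂ c₃)

Relevant : (N a₁ a₂ a₃ b₁ b₂ b₃ p : ℕ) → Set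
Relevant N a₁ a₂ a₃ b₁ b₂ b₃ p =
  Prime p × (p ∣ N * (N ∸ 1) * (N ∸ 2))
    × ¬ Acceptable p N a₁ a₂ a₃ × ¬ Acceptable p N b₁ b₂ b₃

relevant? : (N a₁ a₂ a₃ b₁ b₂ b₃ p : ℕ) → Dec (Relevant N a₁ a₂ a₃ b₁ b₂ b₃ p)
relevant? N a₁ a₂ a₃ b₁ b₂ b₃ p =
  prime? p ×-dec (p ∣? N * (N ∸ 1) * (N ∸ 2))
    ×-dec ¬? (acceptable? p N a₁ a₂ a₃) ×-dec ¬? (acceptable? p N b₁ b₂ b₃)

-- p-adic valuation with fuel: number of times p divides m
-- (0 if p ≤ 1 or m = 0).
valuationFuel : ℕ → ℕ → ℕ → ℕ
valuationFuel zero p m = 0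
valuationFuel (suc f) zero m = 0
valuationFuel (suc f) (suc zero) m = 0
valuationFuel (suc f) p@(suc (suc k)) m =
  if not (does (m ≟ 0)) ∧ does (p ∣? m)
  then suc (valuationFuel f p (m / p))
  else 0

-- v_p(m): the exponent d with p^d exactly dividing m (fuel m suffices).
valuation : ℕ → ℕ → ℕ
valuation p m = valuationFuel m p m

-- Every relevant prime divides N(N-1)(N-2) with N ≥ 3, hence is ≤ N, so the
-- product ranges over p < N + 1. Factors with exponent 0 contribute 1.
relevantFactor : (N a₁ a₂ a₃ b₁ b₂ b₃ p : ℕ) → ℕ
relevantFactor N a₁ a₂ a₃ b₁ b₂ b₃ p =
  if does (relevant? N a₁ a₂ a₃ b₁ b₂ b₃ p)
  then (p ^ valuation p (N ∸ 2)) * ((p ^ valuation p (N ∸ 1)) ^ 2) * ((p ^ valuation p N) ^ 3)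
  else 1

C : (N a₁ a₂ a₃ b₁ b₂ b₃ : ℕ) → ℕ
C N a₁ a₂ a₃ b₁ b₂ b₃ = product (map (relevantFactor N a₁ a₂ a₃ b₁ b₂ b₃) (upTo (suc N)))

{-# OPTIONS --safe #-}
module Submission where

-- Write s = i + j and k = N − i − j, so that the first multinomial coefficient factors as
-- binom(N; k, s) · binom(s; i, j).  By the absorption identity a·binom(a+b; a) = (a+b)·binom(a+b−1; a−1),
-- a prime dividing a + b but not a divides binom(a+b; a).  If p ∣ N, either p ∣ s, and then p ∤ i
-- or p ∤ j since gcd(i, j) = 1, or p ∤ s; either way p divides one of the two binomial factors.
-- If p ∣ N − 1 and p ∤ s, then p ∤ k because gcd(k, s − 1) = 1, and Pascal's rule splits
-- binom(N; k, s) into two binomials each divisible by p.  So the first decomposition is not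
-- p-acceptable for any prime p ∣ N(N − 1), hence by hypothesis p is not relevant.  A relevant
-- prime therefore contributes exactly its primary part of N − 2 to C, and a product of primary
-- parts of N − 2 at distinct primes divides N − 2.

open import Defs
open import Data.Bool using (if_then_else_)
open import Data.Empty using (⊥-elim)
open import Data.List using ([]; _∷_; map)
open import Data.List.Membership.Propositional using (_∈_)
import Data.List.Relation.Unary.All as All
open import Data.List.Relation.Unary.Any using (here; there)
open import Data.List.Relation.Unary.AllPairs using ([]; _∷_)
open import Data.List.Relation.Unary.Unique.Propositional using (Unique)
open import Data.List.Relation.Unary.Unique.Propositional.Properties using (upTo⁺)
open import Data.Nat
open import Data.Nat.Coprimality using (Coprime; coprime-divisor; coprime-factors)
open import Data.Nat.DivMod using (m*n/n≡m)
open import Data.Nat.Divisibility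
open import Data.Nat.ListAction using (product)
open import Data.Nat.Primality using (Prime; euclidsLemma; prime⇒irreducible; prime⇒nonTrivial)
open import Data.Nat.Properties
open import Data.Nat.Tactic.RingSolver using (solve-∀)
open import Data.Product using (_×_; _,_; proj₁)
open import Data.Sum using (_⊎_; inj₁; inj₂)
open import Relation.Nullary using (¬_; Dec; yes; no; does)
open import Relation.Binary.PropositionalEquality

if-does-elim : ∀ {A P : Set} (R : A → Set) (d : Dec P) {x y : A} →
               (P → R x) → (¬ P → R y) → R (if does d then x else y)
if-does-elim R (yes p) onYes onNo = onYes p
if-does-elim R (no ¬p) onYes onNo = onNo ¬p

prime⇒≢1 : ∀ {p} → Prime p → p ≢ 1
prime⇒≢1 p-prime = nonTrivial⇒≢1 {{prime⇒nonTrivial p-prime}}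

prime∤⇒coprime : ∀ {p n} → Prime p → ¬ p ∣ n → Coprime p n
prime∤⇒coprime p-prime p∤n (d∣p , d∣n) with prime⇒irreducible p-prime d∣p
... | inj₁ d≡1 = d≡1
... | inj₂ refl = ⊥-elim (p∤n d∣n)

coprime∧prime∣⇒∤ : ∀ {p m n} → Prime p → Coprime m n → p ∣ m → ¬ p ∣ n
coprime∧prime∣⇒∤ p-prime c p∣m p∣n = prime⇒≢1 p-prime (c (p∣m , p∣n))

prime∣^⇒∣ : ∀ {p} m v → Prime p → p ∣ m ^ v → p ∣ m
prime∣^⇒∣ m zero    p-prime p∣1 = ⊥-elim (prime⇒≢1 p-prime (∣1⇒≡1 p∣1))
prime∣^⇒∣ m (suc v) p-prime p∣m^v+1 with euclidsLemma m (m ^ v) p-prime p∣m^v+1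
... | inj₁ p∣m   = p∣m
... | inj₂ p∣m^v = prime∣^⇒∣ m v p-prime p∣m^v

coprime-^ˡ : ∀ {m n} v → Coprime m n → Coprime (m ^ v) n
coprime-^ˡ zero    c (d∣1 , _)           = ∣1⇒≡1 d∣1
coprime-^ˡ (suc v) c (d∣m*m^v , d∣n) =
  coprime-^ˡ v c (coprime-factors c (d∣m*m^v , ∣m⇒∣m*n _ d∣n) , d∣n)

coprime∧∣∧∣⇒*∣ : ∀ {m n o} → Coprime m n → m ∣ o → n ∣ o → m * n ∣ o
coprime∧∣∧∣⇒*∣ {m} {n} c m∣kn (divides-refl k) =
  *-monoˡ-∣ n (coprime-divisor c (subst (m ∣_) (*-comm k n) m∣kn))

-- binomial a b is the binomial coefficient (a + b choose a); indexing by the two parts keeps it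
-- symmetric and free of truncated subtraction.
binomial : ℕ → ℕ → ℕ
binomial zero    b       = 1
binomial (suc a) zero    = 1
binomial (suc a) (suc b) = binomial a (suc b) + binomial (suc a) b

binomial-comm : ∀ a b → binomial a b ≡ binomial b a
binomial-comm zero    zero    = refl
binomial-comm zero    (suc b) = refl
binomial-comm (suc a) zero    = refl
binomial-comm (suc a) (suc b) =
  trans (cong₂ _+_ (binomial-comm a (suc b)) (binomial-comm (suc a) b))
        (+-comm (binomial (suc b) a) (binomial b (suc a)))

binomial*!*!≡! : ∀ a b → binomial a b * (a ! * b !) ≡ (a + b) !
binomial*!*!≡! zero    b       = trans (*-identityˡ _) (*-identityˡ _)
binomial*!*!≡! (suc a) zero    =
  trans (*-identityˡ _) (trans (*-identityʳ _) (cong _! (sym (+-identityʳ (suc a)))))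
binomial*!*!≡! (suc a) (suc b) = begin
  (binomial a (suc b) + binomial (suc a) b) * (suc a ! * suc b !)
    ≡⟨ split (binomial a (suc b)) (binomial (suc a) b) (a !) (b !) a b ⟩
  suc a * (binomial a (suc b) * (a ! * suc b !)) + suc b * (binomial (suc a) b * (suc a ! * b !))
    ≡⟨ cong₂ (λ x y → suc a * x + suc b * y)
             (trans (binomial*!*!≡! a (suc b)) (cong _! (+-suc a b))) (binomial*!*!≡! (suc a) b) ⟩
  suc a * suc (a + b) ! + suc b * suc (a + b) !
    ≡⟨ collect a b (suc (a + b) !) ⟩
  suc (suc (a + b)) * suc (a + b) !
    ≡⟨ cong (λ z → suc z !) (sym (+-suc a b)) ⟩
  (suc a + suc b) ! ∎
  where
  open ≡-Reasoning
  split : ∀ x y u v a b →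
    (x + y) * ((suc a * u) * (suc b * v)) ≡ suc a * (x * (u * (suc b * v))) + suc b * (y * ((suc a * u) * v))
  split = solve-∀
  collect : ∀ a b f → suc a * f + suc b * f ≡ suc (suc (a + b)) * f
  collect = solve-∀

binomial-absorption : ∀ a b → suc a * binomial (suc a) b ≡ (suc a + b) * binomial a b
binomial-absorption a b =
  *-cancelʳ-≡ _ _ (a ! * b !) {{m*n≢0 (a !) (b !) {{a !≢0}} {{b !≢0}}}} (begin
  suc a * binomial (suc a) b * (a ! * b !)    ≡⟨ regroup (suc a) (binomial (suc a) b) (a !) (b !) ⟩
  binomial (suc a) b * (suc a ! * b !)        ≡⟨ binomial*!*!≡! (suc a) b ⟩
  suc (a + b) * (a + b) !                     ≡⟨ cong (suc (a + b) *_) (binomial*!*!≡! a b) ⟨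
  suc (a + b) * (binomial a b * (a ! * b !))  ≡⟨ *-assoc (suc (a + b)) (binomial a b) (a ! * b !) ⟨
  (suc a + b) * binomial a b * (a ! * b !)    ∎)
  where
  open ≡-Reasoning
  regroup : ∀ x y u v → x * y * (u * v) ≡ y * (x * u * v)
  regroup = solve-∀

multinomial3≡binomial*binomial : ∀ k i j →
  multinomial3 (k + (i + j)) k i j ≡ binomial k (i + j) * binomial i j
multinomial3≡binomial*binomial k i j = begin
  (k + (i + j)) ! / (k ! * i ! * j !)
    ≡⟨ cong (_/ (k ! * i ! * j !)) factorials ⟩
  binomial k (i + j) * binomial i j * (k ! * i ! * j !) / (k ! * i ! * j !)
    ≡⟨ m*n/n≡m (binomial k (i + j) * binomial i j) (k ! * i ! * j !) ⟩
  binomial k (i + j) * binomial i j ∎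
  where
  open ≡-Reasoning
  instance
    _ : NonZero (k ! * i ! * j !)
    _ = m*n≢0 (k ! * i !) (j !) {{m*n≢0 (k !) (i !) {{k !≢0}} {{i !≢0}}}} {{j !≢0}}
  regroup : ∀ x y a b c → x * (a * (y * (b * c))) ≡ x * y * (a * b * c)
  regroup = solve-∀
  factorials : (k + (i + j)) ! ≡ binomial k (i + j) * binomial i j * (k ! * i ! * j !)
  factorials = begin
    (k + (i + j)) !
      ≡⟨ binomial*!*!≡! k (i + j) ⟨
    binomial k (i + j) * (k ! * (i + j) !)
      ≡⟨ cong (λ z → binomial k (i + j) * (k ! * z)) (binomial*!*!≡! i j) ⟨
    binomial k (i + j) * (k ! * (binomial i j * (i ! * j !)))
      ≡⟨ regroup (binomial k (i + j)) (binomial i j) (k !) (i !) (j !) ⟩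
    binomial k (i + j) * binomial i j * (k ! * i ! * j !) ∎

prime∤∧∣+⇒∣binomial : ∀ {p} a b → Prime p → ¬ p ∣ a → p ∣ a + b → p ∣ binomial a b
prime∤∧∣+⇒∣binomial zero    b p-prime p∤a p∣a+b = ⊥-elim (p∤a (_ ∣0))
prime∤∧∣+⇒∣binomial {p} (suc a) b p-prime p∤a p∣a+b
  with euclidsLemma (suc a) (binomial (suc a) b) p-prime
         (subst (p ∣_) (sym (binomial-absorption a b)) (∣m⇒∣m*n (binomial a b) p∣a+b))
... | inj₁ p∣a = ⊥-elim (p∤a p∣a)
... | inj₂ p∣binomial = p∣binomial

coprime∧∣+⇒∣binomial : ∀ {p} a b → Prime p → Coprime a b → p ∣ a + b → p ∣ binomial a b
coprime∧∣+⇒∣binomial {p} a b p-prime c p∣a+b with p ∣? a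
... | no p∤a = prime∤∧∣+⇒∣binomial a b p-prime p∤a p∣a+b
... | yes p∣a = subst (p ∣_) (binomial-comm b a)
  (prime∤∧∣+⇒∣binomial b a p-prime (coprime∧prime∣⇒∤ p-prime c p∣a)
                       (subst (p ∣_) (+-comm a b) p∣a+b))

prime∤∧∤∧∣+⇒∣binomial-suc : ∀ {p} a b → Prime p → ¬ p ∣ a → ¬ p ∣ suc b → p ∣ a + b →
                            p ∣ binomial a (suc b)
prime∤∧∤∧∣+⇒∣binomial-suc {p} zero    b p-prime p∤a p∤b+1 p∣a+b = ⊥-elim (p∤a (p ∣0))
prime∤∧∤∧∣+⇒∣binomial-suc {p} (suc a) b p-prime p∤a p∤b+1 p∣a+b = ∣m∣n⇒∣m+n
  (subst (p ∣_) (binomial-comm (suc b) a)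
    (prime∤∧∣+⇒∣binomial (suc b) a p-prime p∤b+1 (subst (λ n → p ∣ suc n) (+-comm a b) p∣a+b)))
  (prime∤∧∣+⇒∣binomial (suc a) b p-prime p∤a p∣a+b)

coprime∧∣+∸1⇒∣binomial : ∀ {p} a b → Prime p → Coprime a (b ∸ 1) → ¬ p ∣ b → p ∣ a + b ∸ 1 →
                         p ∣ binomial a b
coprime∧∣+∸1⇒∣binomial {p} a zero    p-prime c p∤b p∣a+b-1 = ⊥-elim (p∤b (p ∣0))
coprime∧∣+∸1⇒∣binomial {p} a (suc b) p-prime c p∤b p∣a+b-1 = by-cases (p ∣? a)
  where
  p∣a+b : p ∣ a + b
  p∣a+b = subst (λ n → p ∣ n ∸ 1) (+-suc a b) p∣a+b-1
  by-cases : Dec (p ∣ a) → p ∣ binomial a (suc b)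
  by-cases (yes p∣a) = ⊥-elim (coprime∧prime∣⇒∤ p-prime c p∣a (∣m+n∣m⇒∣n p∣a+b p∣a))
  by-cases (no p∤a)  = prime∤∧∤∧∣+⇒∣binomial-suc a b p-prime p∤a p∤b p∣a+b

prime∣N⇒∣multinomial3 : ∀ {p N} k i j → k + (i + j) ≡ N → Prime p → Coprime i j → p ∣ N →
                        p ∣ multinomial3 N k i j
prime∣N⇒∣multinomial3 {p} k i j refl p-prime i⊥j p∣N =
  subst (p ∣_) (sym (multinomial3≡binomial*binomial k i j)) (by-cases (p ∣? (i + j)))
  where
  by-cases : Dec (p ∣ i + j) → p ∣ binomial k (i + j) * binomial i j
  by-cases (yes p∣i+j) = ∣n⇒∣m*n (binomial k (i + j)) (coprime∧∣+⇒∣binomial i j p-prime i⊥j p∣i+j)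
  by-cases (no p∤i+j)  = ∣m⇒∣m*n (binomial i j) (subst (p ∣_) (binomial-comm (i + j) k)
    (prime∤∧∣+⇒∣binomial (i + j) k p-prime p∤i+j (subst (p ∣_) (+-comm k (i + j)) p∣N)))

prime∣N∸1⇒∣multinomial3 : ∀ {p N} k i j → k + (i + j) ≡ N → Prime p → Coprime i j →
                          Coprime k (i + j ∸ 1) → p ∣ N ∸ 1 → p ∣ multinomial3 N k i j
prime∣N∸1⇒∣multinomial3 {p} k i j refl p-prime i⊥j k⊥i+j-1 p∣N∸1 =
  subst (p ∣_) (sym (multinomial3≡binomial*binomial k i j)) (by-cases (p ∣? (i + j)))
  where
  by-cases : Dec (p ∣ i + j) → p ∣ binomial k (i + j) * binomial i j
  by-cases (yes p∣i+j) = ∣n⇒∣m*n (binomial k (i + j)) (coprime∧∣+⇒∣binomial i j p-prime i⊥j p∣i+j)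
  by-cases (no p∤i+j)  = ∣m⇒∣m*n (binomial i j)
    (coprime∧∣+∸1⇒∣binomial k (i + j) p-prime k⊥i+j-1 p∤i+j p∣N∸1)

valuationFuel-∣ : ∀ f p m → p ^ valuationFuel f p m ∣ m
valuationFuel-∣ zero    p                 m        = 1∣ m
valuationFuel-∣ (suc f) zero              m        = 1∣ m
valuationFuel-∣ (suc f) (suc zero)        m        = 1∣ m
valuationFuel-∣ (suc f) (suc (suc k))     zero     = 1∣ 0
valuationFuel-∣ (suc f) p@(suc (suc k)) m@(suc _) with m % p in m%p≡0
... | zero  = m∣n/o⇒o*m∣n (m%n≡0⇒n∣m m p m%p≡0) (valuationFuel-∣ f p (m / p))
... | suc _ = 1∣ m

valuationFuel-∤ : ∀ f p m → ¬ p ∣ m → valuationFuel f p m ≡ 0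
valuationFuel-∤ zero    p                 m        p∤m = refl
valuationFuel-∤ (suc f) zero              m        p∤m = refl
valuationFuel-∤ (suc f) (suc zero)        m        p∤m = refl
valuationFuel-∤ (suc f) (suc (suc k))     zero     p∤m = refl
valuationFuel-∤ (suc f) p@(suc (suc k)) m@(suc _) p∤m with m % p in m%p≡0
... | zero  = ⊥-elim (p∤m (m%n≡0⇒n∣m m p m%p≡0))
... | suc _ = refl

data OneOrPrimaryPart (m q : ℕ) : ℕ → Set where
  one     : OneOrPrimaryPart m q 1
  primary : Prime q → OneOrPrimaryPart m q (q ^ valuation q m)

prime∣OneOrPrimaryPart⇒≡ : ∀ {m q r x} → OneOrPrimaryPart m q x → Prime r → r ∣ x → r ≡ q
prime∣OneOrPrimaryPart⇒≡ one r-prime r∣1 = ⊥-elim (prime⇒≢1 r-prime (∣1⇒≡1 r∣1))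
prime∣OneOrPrimaryPart⇒≡ {m} {q} (primary q-prime) r-prime r∣q^v
  with prime⇒irreducible q-prime (prime∣^⇒∣ q (valuation q m) r-prime r∣q^v)
... | inj₁ refl = ⊥-elim (prime⇒≢1 r-prime refl)
... | inj₂ r≡q  = r≡q

prime∣product⇒∈ : ∀ {m r} {f : ℕ → ℕ} xs → (∀ q → OneOrPrimaryPart m q (f q)) → Prime r →
                  r ∣ product (map f xs) → r ∈ xs
prime∣product⇒∈ []       parts r-prime r∣1 = ⊥-elim (prime⇒≢1 r-prime (∣1⇒≡1 r∣1))
prime∣product⇒∈ {f = f} (q ∷ xs) parts r-prime r∣product
  with euclidsLemma (f q) (product (map f xs)) r-prime r∣product
... | inj₁ r∣fq   = here (prime∣OneOrPrimaryPart⇒≡ (parts q) r-prime r∣fq)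
... | inj₂ r∣rest = there (prime∣product⇒∈ xs parts r-prime r∣rest)

OneOrPrimaryPart-*-∣ : ∀ {m q x n} → OneOrPrimaryPart m q x → (Prime q → ¬ q ∣ n) → n ∣ m → x * n ∣ m
OneOrPrimaryPart-*-∣ {m} one q∤n n∣m = subst (_∣ m) (sym (*-identityˡ _)) n∣m
OneOrPrimaryPart-*-∣ {m} {q} (primary q-prime) q∤n n∣m =
  coprime∧∣∧∣⇒*∣ (coprime-^ˡ (valuation q m) (prime∤⇒coprime q-prime (q∤n q-prime)))
                 (valuationFuel-∣ m q m) n∣m

product-OneOrPrimaryPart-∣ : ∀ {m} {f : ℕ → ℕ} {xs} → (∀ q → OneOrPrimaryPart m q (f q)) → Unique xs →
                             product (map f xs) ∣ m
product-OneOrPrimaryPart-∣ {m} parts [] = 1∣ m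
product-OneOrPrimaryPart-∣ {f = f} {q ∷ xs} parts (q∉xs ∷ unique) =
  OneOrPrimaryPart-*-∣ (parts q) q∤rest (product-OneOrPrimaryPart-∣ parts unique)
  where
  q∤rest : Prime q → ¬ q ∣ product (map f xs)
  q∤rest q-prime q∣rest = All.lookup q∉xs (prime∣product⇒∈ xs parts q-prime q∣rest) refl

relevantFactor-OneOrPrimaryPart : ∀ N a₁ a₂ a₃ b₁ b₂ b₃ →
  (∀ p → Prime p → p ∣ N ⊎ p ∣ N ∸ 1 → ¬ Relevant N a₁ a₂ a₃ b₁ b₂ b₃ p) →
  ∀ q → OneOrPrimaryPart (N ∸ 2) q (relevantFactor N a₁ a₂ a₃ b₁ b₂ b₃ q)
relevantFactor-OneOrPrimaryPart N a₁ a₂ a₃ b₁ b₂ b₃ irrelevant q =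
  if-does-elim (OneOrPrimaryPart (N ∸ 2) q) (relevant? N a₁ a₂ a₃ b₁ b₂ b₃ q)
    (λ relevant → subst (OneOrPrimaryPart (N ∸ 2) q) (sym (factor≡ relevant)) (primary (proj₁ relevant)))
    (λ _ → one)
  where
  factor≡ : Relevant N a₁ a₂ a₃ b₁ b₂ b₃ q →
    q ^ valuation q (N ∸ 2) * (q ^ valuation q (N ∸ 1)) ^ 2 * (q ^ valuation q N) ^ 3 ≡ q ^ valuation q (N ∸ 2)
  factor≡ relevant@(q-prime , _) = begin
    q ^ valuation q (N ∸ 2) * (q ^ valuation q (N ∸ 1)) ^ 2 * (q ^ valuation q N) ^ 3
      ≡⟨ cong₂ (λ u w → q ^ valuation q (N ∸ 2) * (q ^ u) ^ 2 * (q ^ w) ^ 3)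
               (valuationFuel-∤ (N ∸ 1) q (N ∸ 1) (λ q∣N∸1 → irrelevant q q-prime (inj₂ q∣N∸1) relevant))
               (valuationFuel-∤ N q N (λ q∣N → irrelevant q q-prime (inj₁ q∣N) relevant)) ⟩
    q ^ valuation q (N ∸ 2) * 1 * 1
      ≡⟨ trans (*-identityʳ _) (*-identityʳ _) ⟩
    q ^ valuation q (N ∸ 2) ∎
    where open ≡-Reasoning

lemma8p1 : (N i j a₁ a₂ a₃ b₁ b₂ b₃ : ℕ) →
    1 ≤ i → 1 ≤ j → i + j < N →
    1 ≤ a₁ → 1 ≤ a₂ → 1 ≤ a₃ → a₁ + a₂ + a₃ ≡ N →
    1 ≤ b₁ → 1 ≤ b₂ → 1 ≤ b₃ → b₁ + b₂ + b₃ ≡ N →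
    (∀ p → Prime p → p ∣ N * (N ∸ 1) * (N ∸ 2) →
      Acceptable p N (N ∸ i ∸ j) i j ⊎ Acceptable p N a₁ a₂ a₃ ⊎ Acceptable p N b₁ b₂ b₃) →
    Coprime i j →
    Coprime (N ∸ i ∸ j) (i + j ∸ 1) →
    (∀ p → Prime p → (p ∣ N ⊎ p ∣ N ∸ 1) → ¬ Relevant N a₁ a₂ a₃ b₁ b₂ b₃ p)
    × (C N a₁ a₂ a₃ b₁ b₂ b₃ ∣ N ∸ 2)
lemma8p1 N i j a₁ a₂ a₃ b₁ b₂ b₃ _ _ i+j<N _ _ _ _ _ _ _ _ someAcceptable i⊥j k⊥i+j-1 =
  irrelevant ,
  product-OneOrPrimaryPart-∣ (relevantFactor-OneOrPrimaryPart N a₁ a₂ a₃ b₁ b₂ b₃ irrelevant) (upTo⁺ (suc N))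
  where
  k = N ∸ i ∸ j
  k+[i+j]≡N : k + (i + j) ≡ N
  k+[i+j]≡N = trans (cong (_+ (i + j)) (∸-+-assoc N i j)) (m∸n+n≡m (<⇒≤ i+j<N))
  ¬acceptable : ∀ {p} → Prime p → p ∣ N ⊎ p ∣ N ∸ 1 → ¬ Acceptable p N k i j
  ¬acceptable p-prime (inj₁ p∣N) acceptable =
    acceptable (prime∣N⇒∣multinomial3 k i j k+[i+j]≡N p-prime i⊥j p∣N)
  ¬acceptable p-prime (inj₂ p∣N∸1) acceptable =
    acceptable (prime∣N∸1⇒∣multinomial3 k i j k+[i+j]≡N p-prime i⊥j k⊥i+j-1 p∣N∸1)
  irrelevant : ∀ p → Prime p → p ∣ N ⊎ p ∣ N ∸ 1 → ¬ Relevant N a₁ a₂ a₃ b₁ b₂ b₃ p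
  irrelevant p p-prime p∣N⊎N∸1 (_ , p∣N[N-1][N-2] , ¬acceptable-a , ¬acceptable-b)
    with someAcceptable p p-prime p∣N[N-1][N-2]
  ... | inj₁ acceptable-k         = ¬acceptable p-prime p∣N⊎N∸1 acceptable-k
  ... | inj₂ (inj₁ acceptable-a) = ¬acceptable-a acceptable-a
  ... | inj₂ (inj₂ acceptable-b) = ¬acceptable-b acceptable-b
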